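{- Let $U\subseteq L_{\mathrm{up}}$ be a set of up-links such that the sets $P_u$, $u\in U$, are pairwise disjoint, and let $(C,A)$ be a connected component of the dependency graph of $U$. Let $\ell \in C$ and let $H_{\ell}$ be the arc set of the path from the root of the arborescence $(C,A)$ to $\ell$. Then \[\left|\left\{ \bar \ell \in C\setminus \{\ell\} \colon \mathrm{apex}(\ell) \in V_{\bar \ell} \right\}\right| \le \left|\left\{ u\in U \colon H_{\ell} \cap A_u \ne \emptyset \right\}\right|.\]
   Context: Let $G=(V,E)$ be a tree with links $L\subseteq\binom{V}{2}$, and fix a root $r\in V$. For a link $\ell$, $P_\ell$ is the edge set of the path in $G$ between its endpoints and $V_\ell$ its vertex set. $z$ is an ancestor of $v$ in $G$ if $z$ lies on the $r$-$v$ path (including $r,v$); descendant is the converse. $\mathrm{apex}(\ell)$ is the vertex of $V_\ell$ closest to $r$. An up-link is a link $\{t,b\}$ with $t$ an ancestor of $b$; $L_{\mathrm{up}}$ is the set of up-links. Let $F\subseteq L$ satisfy $\bigcup_{\ell\in F}P_\ell=E$. For $v\in V$ let $B_v=\{\ell\in F\colon \mathrm{apex}(\ell)\text{ is a descendant of }v\}$. For $u=\{t,b\}\in L_{\mathrm{up}}$ with $t$ an ancestor of $b$, let $v_u$ be the ancestor of $t$ farthest from $r$ with $P_u\subseteq\bigcup_{\ell\in B_{v_u}}P_\ell$, and let $F_u\subseteq B_{v_u}$ be a fixed inclusion-wise minimal set with $P_u\subseteq\bigcup_{\ell\in F_u}P_\ell$. For $\ell\in F_u$, $P_{u,\ell}:=P_u\setminus\bigcup_{\bar\ell\in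 F_u\setminus\{\ell\}}P_{\bar\ell}$; these are nonempty, pairwise disjoint edge sets of subpaths of the $t$-$b$ path. Define $\ell_1\prec_u\ell_2$ iff the edges of $P_{u,\ell_1}$ appear before those of $P_{u,\ell_2}$ on the $t$-$b$ path. If $\ell_1\prec_u\cdots\prec_u\ell_q$ are the links of $F_u$, then $A_u:=\{(\ell_i,\ell_{i+1})\colon i=1,\dots,q-1\}$. The dependency graph of $U$ is the directed graph with vertex set $F$ whose arc set is the disjoint union of the $A_u$, $u\in U$. When the $P_u$, $u\in U$, are pairwise disjoint, this graph is a branching, so each of its (weakly) connected components $(C,A)$ is an arborescence. -}

module Defs where

open import Data.Nat using (ℕ; zero; suc; _≤_; _<_)
open import Data.Fin using (Fin)
open import Data.Product using (Σ; ∃; ∃-syntax; _×_; _,_)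
open import Data.Sum using (_⊎_)
open import Data.List using (List; length)
open import Data.List.Membership.Propositional using (_∈_)
open import Data.List.Relation.Unary.Unique.Propositional using (Unique)
open import Relation.Nullary using (¬_)
open import Relation.Binary.PropositionalEquality using (_≡_; _≢_)

-- The edges of the tree are
-- {v , parent v} for v ≢ root; we identify such an edge with its lower
-- endpoint v.  Every tree with a chosen root arises uniquely this way.

record RootedTree (n : ℕ) : Set where
  field
    root         : Fin n
    parent       : Fin n → Fin n
    depth        : Fin n → ℕ
    depth-root   : depth root ≡ 0
    depth-parent : ∀ v → v ≢ root → suc (depth (parent v)) ≡ depth v

record Links (n m : ℕ) : Set where
  field
    a        : Fin m → Fin n
    b        : Fin m → Fin n
    distinct : ∀ i → a i ≢ b i
    noDup    : ∀ i j → i ≢ j →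
               ¬ ((a i ≡ a j × b i ≡ b j) ⊎ (a i ≡ b j × b i ≡ a j))

module Setup {n m : ℕ} (T : RootedTree n) (L : Links n m) where
  open RootedTree T
  open Links L

  data Anc (z : Fin n) : Fin n → Set where
    anc-refl : Anc z z
    anc-step : ∀ {v} → v ≢ root → Anc z (parent v) → Anc z v

  -- Edge sets of tree paths: the tree edge {c , parent c} (c ≢ root)
  -- lies on the x–y path iff exactly one of x , y is a descendant of c.
  PathBetween : Fin n → Fin n → Fin n → Set
  PathBetween x y c =
    c ≢ root × (Anc c x ⊎ Anc c y) × ¬ (Anc c x × Anc c y)

  P : Fin m → Fin n → Set
  P i c = PathBetween (a i) (b i) c

  V : Fin m → Fin n → Set
  V i w = ∃[ c ] (P i c × (w ≡ c ⊎ w ≡ parent c))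

  IsApex : Fin m → Fin n → Set
  IsApex i w = V i w × (∀ w' → V i w' → depth w ≤ depth w')

  Top : Fin m → Fin n → Set
  Top u t = (t ≡ a u × Anc (a u) (b u)) ⊎ (t ≡ b u × Anc (b u) (a u))

  UpLink : Fin m → Set
  UpLink u = Anc (a u) (b u) ⊎ Anc (b u) (a u)

  Covers : (Fin m → Set) → Fin m → Set
  Covers S u = ∀ c → P u c → ∃[ ℓ ] (S ℓ × P ℓ c)

  module WithF (F : Fin m → Set) where

    CoversTree : Set
    CoversTree = ∀ c → c ≢ root → ∃[ ℓ ] (F ℓ × P ℓ c)

    B : Fin n → Fin m → Set
    B v ℓ = F ℓ × ∃[ w ] (IsApex ℓ w × Anc v w)

    IsVu : Fin m → Fin n → Set
    IsVu u v = ∃[ t ] (Top u t × Anc v t × Covers (B v) u ×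
                 (∀ v' → Anc v' t → Covers (B v') u → depth v' ≤ depth v))

    module WithU (U : Fin m → Set) (Fu : Fin m → Fin m → Set) where

      ValidChoice : Set₁
      ValidChoice = ∀ u → U u → ∃[ v ] (IsVu u v ×
                      (∀ ℓ → Fu u ℓ → B v ℓ) ×
                      Covers (Fu u) u ×
                      (∀ (S : Fin m → Set) → (∀ ℓ → S ℓ → Fu u ℓ) →
                         Covers S u → ∀ ℓ → Fu u ℓ → S ℓ))

      Pu : Fin m → Fin m → Fin n → Set
      Pu u ℓ c = P u c × (∀ ℓ' → Fu u ℓ' → ℓ' ≢ ℓ → ¬ P ℓ' c)

      Prec : Fin m → Fin m → Fin m → Set
      Prec u ℓ₁ ℓ₂ = ∀ c₁ c₂ → Pu u ℓ₁ c₁ → Pu u ℓ₂ c₂ → depth c₁ < depth c₂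

      Arc : Fin m → Fin m → Fin m → Set
      Arc u ℓ₁ ℓ₂ = U u × Fu u ℓ₁ × Fu u ℓ₂ × Prec u ℓ₁ ℓ₂ ×
                    ¬ (∃[ ℓ₃ ] (Fu u ℓ₃ × Prec u ℓ₁ ℓ₃ × Prec u ℓ₃ ℓ₂))

      data Conn : Fin m → Fin m → Set where
        conn-refl : ∀ {x} → Conn x x
        conn-fwd  : ∀ {x y z} u → Arc u x y → Conn y z → Conn x z
        conn-bwd  : ∀ {x y z} u → Arc u y x → Conn y z → Conn x z

      -- directed paths in the dependency graph; arcs carry their label u
      -- (the arc set is the disjoint union of the A_u)
      data DPath : Fin m → Fin m → Set where
        []  : ∀ {x} → DPath x x
        step : ∀ {x y z} u → Arc u x y → DPath y z → DPath x z

      data UsesLabel : ∀ {x y} → DPath x y → Fin m → Set where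
        here  : ∀ {x y z u} (e : Arc u x y) (p : DPath y z) →
                UsesLabel (step u e p) u
        there : ∀ {x y z u u'} (e : Arc u x y) (p : DPath y z) →
                UsesLabel p u' → UsesLabel (step u e p) u'

-- |X| ≤ |Y| for finite sets of link indices, via duplicate-free
-- enumerations: every enumeration of X is no longer than every
-- enumeration of Y.
CardLe : ∀ {m} → (Fin m → Set) → (Fin m → Set) → Set
CardLe {m} X Y = (xs ys : List (Fin m)) → Unique xs → Unique ys →
  (∀ x → (x ∈ xs → X x) × (X x → x ∈ xs)) →
  (∀ y → (y ∈ ys → Y y) × (Y y → y ∈ ys)) →
  length xs ≤ length ys

{-# OPTIONS --safe #-}
-- For an arc (x , y) of A_u the tree edge just above apex y lies on both P_u and P_x.
-- Hence apexes strictly descend along arcs and, the P_u being disjoint, every link has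
-- in-degree at most one, so every link of the component is reached from the root ρ by
-- a directed path.  If ℓ̄ ≠ ℓ in the component passes through apex ℓ, then ℓ̄ lies on H:
-- where the paths from ρ to ℓ and to ℓ̄ would first diverge, two arcs with the same label
-- contradict the consecutiveness of A_u, and two arcs with labels u ≠ u′ give a set
-- B (apex y) covering P_{u′} whose apex y lies deeper than v_{u′}, against the maximality
-- of v_{u′}.  Sending ℓ̄ to the label of its outgoing arc on H is injective: two links
-- leaving H by arcs of the same A_u cannot both pass through apex ℓ.
--
-- Facts about the order ≺_u need the sets P_{u,ℓ} to be nonempty, which only holds
-- classically; they are proved in the double-negation monad, and every conclusion
-- drawn from them is stable (decidable, negative, or like ≺_u a ∀ of decidable facts).
module Submission where

open import Defs
open import Level using (0ℓ)
open import Data.Nat using (ℕ; zero; suc; _≤_; _<_; z≤n; s≤s)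
open import Data.Nat.Properties
  using (_<?_; ≤-refl; ≤-trans; ≤-<-trans; <-trans; <-irrefl; ≤-antisym; <⇒≤; n≮n; suc-injective)
open import Data.Fin using (Fin; _≟_)
open import Data.Fin.Properties using (sequence)
open import Data.Product using (∃; ∃-syntax; _×_; _,_; proj₁; proj₂; map₂)
open import Data.Sum using (_⊎_; inj₁; inj₂) renaming (map to ⊎-map)
open import Data.Empty using (⊥; ⊥-elim)
open import Data.List using (List; []; _∷_; length)
open import Data.List.Membership.Propositional using (_∈_)
open import Data.List.Relation.Unary.Any using (here; there)
open import Data.List.Relation.Unary.All as All using (All; []; _∷_)
open import Data.List.Relation.Unary.AllPairs using (_∷_)
open import Data.List.Relation.Unary.Unique.Propositional using (Unique)
open import Function using (case_of_)
open import Effect.Monad using (RawMonad)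
open import Relation.Binary.Definitions using (DecidableEquality)
open import Relation.Nullary using (¬_; Dec; yes; no)
open import Relation.Nullary.Decidable using (decidable-stable; ¬?; _×-dec_; _⊎-dec_)
open import Relation.Nullary.Negation using (DoubleNegation; ¬¬-Monad; ¬¬-map)
open import Relation.Binary.PropositionalEquality using (_≡_; _≢_; refl; sym; trans; subst; ≢-sym)

open RawMonad {0ℓ} ¬¬-Monad using (_>>=_; pure; rawApplicative)

¬¬-∀-Fin : ∀ {k} {B : Fin k → Set} → (∀ i → DoubleNegation (B i)) → DoubleNegation (∀ i → B i)
¬¬-∀-Fin = sequence rawApplicative

¬¬-→ : ∀ {A B : Set} → (A → DoubleNegation B) → DoubleNegation (A → B)
¬¬-→ f k = k (λ a → ⊥-elim (f a (λ b → k (λ _ → b))))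

module _ {A B : Set} (_≟ᴮ_ : DecidableEquality B) where

  remove : B → List B → List B
  remove y [] = []
  remove y (z ∷ zs) with y ≟ᴮ z
  ... | yes _ = zs
  ... | no _  = z ∷ remove y zs

  length-remove : ∀ {y} ys → y ∈ ys → suc (length (remove y ys)) ≤ length ys
  length-remove {y} (z ∷ zs) y∈ with y ≟ᴮ z
  length-remove (z ∷ zs) y∈          | yes _ = ≤-refl
  length-remove (z ∷ zs) (here refl) | no y≢z = ⊥-elim (y≢z refl)
  length-remove (z ∷ zs) (there y∈)  | no _   = s≤s (length-remove zs y∈)

  ∈-remove : ∀ {y y'} ys → y' ∈ ys → y' ≢ y → y' ∈ remove y ys
  ∈-remove {y} (z ∷ zs) y'∈ y'≢y with y ≟ᴮ z
  ∈-remove (z ∷ zs) (here refl) y'≢y | yes refl = ⊥-elim (y'≢y refl)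
  ∈-remove (z ∷ zs) (there y'∈) y'≢y | yes refl = y'∈
  ∈-remove (z ∷ zs) (here refl) y'≢y | no _     = here refl
  ∈-remove (z ∷ zs) (there y'∈) y'≢y | no _     = there (∈-remove zs y'∈ y'≢y)

  length-≤-by-injection : ∀ {R : A → B → Set} xs ys → Unique xs →
    All (λ x → ∃[ y ] (y ∈ ys × R x y)) xs →
    (∀ {x x' y} → x ∈ xs → x' ∈ xs → R x y → R x' y → x ≡ x') →
    length xs ≤ length ys
  length-≤-by-injection [] ys _ _ _ = z≤n
  length-≤-by-injection {R} (x ∷ xs) ys (x∉xs ∷ uxs) ((y , y∈ys , Rxy) ∷ images) inj =
    ≤-trans (s≤s (length-≤-by-injection xs (remove y ys) uxs images′ (λ i i′ → inj (there i) (there i′))))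
            (length-remove ys y∈ys)
    where
      images′ : All (λ x′ → ∃[ y′ ] (y′ ∈ remove y ys × R x′ y′)) xs
      images′ = All.tabulate λ x′∈xs → case All.lookup images x′∈xs of λ where
        (y′ , y′∈ys , Rx′y′) → y′ , ∈-remove ys y′∈ys (λ { refl →
          All.lookup x∉xs x′∈xs (inj (here refl) (there x′∈xs) Rxy Rx′y′) }) , Rx′y′

module Tree {n m : ℕ} (T : RootedTree n) (L : Links n m) where
  open RootedTree T
  open Links L
  open Setup T L public

  depth-parent-< : ∀ {v} → v ≢ root → depth (parent v) < depth v
  depth-parent-< {v} v≢r rewrite sym (depth-parent v v≢r) = ≤-refl

  Anc⇒depth-≤ : ∀ {z v} → Anc z v → depth z ≤ depth v
  Anc⇒depth-≤ anc-refl          = ≤-refl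
  Anc⇒depth-≤ (anc-step v≢r zv) = <⇒≤ (≤-<-trans (Anc⇒depth-≤ zv) (depth-parent-< v≢r))

  Anc-trans : ∀ {x y z} → Anc x y → Anc y z → Anc x z
  Anc-trans xy anc-refl          = xy
  Anc-trans xy (anc-step z≢r yz) = anc-step z≢r (Anc-trans xy yz)

  Anc-depth-≡⇒≡ : ∀ {z v} → Anc z v → depth z ≡ depth v → z ≡ v
  Anc-depth-≡⇒≡ anc-refl          _  = refl
  Anc-depth-≡⇒≡ (anc-step v≢r zv) eq =
    ⊥-elim (<-irrefl eq (≤-<-trans (Anc⇒depth-≤ zv) (depth-parent-< v≢r)))

  Anc-antisym : ∀ {x y} → Anc x y → Anc y x → x ≡ y
  Anc-antisym xy yx = Anc-depth-≡⇒≡ xy (≤-antisym (Anc⇒depth-≤ xy) (Anc⇒depth-≤ yx))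

  Anc-total : ∀ {x y v} → Anc x v → Anc y v → Anc x y ⊎ Anc y x
  Anc-total anc-refl          yv                = inj₂ yv
  Anc-total (anc-step v≢r xv) anc-refl          = inj₁ (anc-step v≢r xv)
  Anc-total (anc-step _ xv)   (anc-step _ yv)   = Anc-total xv yv

  Anc-of-root : ∀ {z} → Anc z root → z ≡ root
  Anc-of-root anc-refl          = refl
  Anc-of-root (anc-step r≢r _) = ⊥-elim (r≢r refl)

  root-Anc : ∀ v → Anc root v
  root-Anc v = go _ v refl
    where
      go : ∀ k v → depth v ≡ k → Anc root v
      go k v eq with v ≟ root
      ... | yes refl = anc-refl
      go zero    v eq | no v≢r = ⊥-elim (n≮n 0 (subst (0 <_) eq (≤-<-trans z≤n (depth-parent-< v≢r))))
      go (suc k) v eq | no v≢r = anc-step v≢r (go k (parent v) (suc-injective (trans (depth-parent v v≢r) eq)))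

  -- recursion on root-Anc v walks from v up to the root
  Anc? : ∀ z v → Dec (Anc z v)
  Anc? z v = go (root-Anc v)
    where
      go : ∀ {v} → Anc root v → Dec (Anc z v)
      go anc-refl with z ≟ root
      ... | yes refl = yes anc-refl
      ... | no z≢r   = no (λ zr → z≢r (Anc-of-root zr))
      go {v} (anc-step v≢r rp) with z ≟ v
      ... | yes refl = yes anc-refl
      ... | no z≢v with go rp
      ...   | yes zp = yes (anc-step v≢r zp)
      ...   | no ¬zp = no λ { anc-refl → z≢v refl ; (anc-step _ zp) → ¬zp zp }

  record LowestCommonAnc (p q : Fin n) : Set where
    field
      lca      : Fin n
      lca-anc₁ : Anc lca p
      lca-anc₂ : Anc lca q
      lca-max  : ∀ z → Anc z p → Anc z q → Anc z lca

  lowestCommonAnc : ∀ p q → LowestCommonAnc p q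
  lowestCommonAnc p q = go (root-Anc p)
    where
      go : ∀ {p} → Anc root p → LowestCommonAnc p q
      go anc-refl = record
        { lca = root ; lca-anc₁ = anc-refl ; lca-anc₂ = root-Anc q ; lca-max = λ _ zr _ → zr }
      go {p} (anc-step p≢r rp) with Anc? p q
      ... | yes pq = record
        { lca = p ; lca-anc₁ = anc-refl ; lca-anc₂ = pq ; lca-max = λ _ zp _ → zp }
      ... | no ¬pq = let open LowestCommonAnc (go rp) in record
        { lca = lca ; lca-anc₁ = anc-step p≢r lca-anc₁ ; lca-anc₂ = lca-anc₂
        ; lca-max = λ { _ anc-refl zq → ⊥-elim (¬pq zq) ; z (anc-step _ zp) zq → lca-max z zp zq } }

  -- c ≢ root makes c a tree edge as well, so ProperAnc x c also says that x lies above the edge c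
  ProperAnc : Fin n → Fin n → Set
  ProperAnc x c = c ≢ root × Anc x (parent c)

  ProperAnc⇒Anc : ∀ {x c} → ProperAnc x c → Anc x c
  ProperAnc⇒Anc (c≢r , xp) = anc-step c≢r xp

  ProperAnc⇒depth-< : ∀ {x c} → ProperAnc x c → depth x < depth c
  ProperAnc⇒depth-< (c≢r , xp) = ≤-<-trans (Anc⇒depth-≤ xp) (depth-parent-< c≢r)

  ProperAnc-irrefl : ∀ {x} → ¬ ProperAnc x x
  ProperAnc-irrefl xx = <-irrefl refl (ProperAnc⇒depth-< xx)

  ProperAnc⇒¬Anc : ∀ {x c} → ProperAnc x c → ¬ Anc c x
  ProperAnc⇒¬Anc xc cx = <-irrefl refl (≤-<-trans (Anc⇒depth-≤ cx) (ProperAnc⇒depth-< xc))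

  Anc∧≢⇒ProperAnc : ∀ {x c} → Anc x c → x ≢ c → ProperAnc x c
  Anc∧≢⇒ProperAnc anc-refl          x≢x = ⊥-elim (x≢x refl)
  Anc∧≢⇒ProperAnc (anc-step c≢r xp) _   = c≢r , xp

  ProperAnc-transˡ : ∀ {x y c} → Anc x y → ProperAnc y c → ProperAnc x c
  ProperAnc-transˡ xy (c≢r , yp) = c≢r , Anc-trans xy yp

  ProperAnc-transʳ : ∀ {x c d} → ProperAnc x c → Anc c d → ProperAnc x d
  ProperAnc-transʳ xc anc-refl          = xc
  ProperAnc-transʳ xc (anc-step d≢r cp) = d≢r , Anc-trans (ProperAnc⇒Anc xc) cp

  Anc-trichotomy : ∀ {x y v} → Anc x v → Anc y v → x ≡ y ⊎ ProperAnc x y ⊎ ProperAnc y x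
  Anc-trichotomy {x} {y} xv yv with x ≟ y | Anc-total xv yv
  ... | yes x≡y | _      = inj₁ x≡y
  ... | no x≢y  | inj₁ xy = inj₂ (inj₁ (Anc∧≢⇒ProperAnc xy x≢y))
  ... | no x≢y  | inj₂ yx = inj₂ (inj₂ (Anc∧≢⇒ProperAnc yx (λ y≡x → x≢y (sym y≡x))))

  child-toward : ∀ {x v} → Anc x v → x ≢ v → ∃[ c ] (c ≢ root × parent c ≡ x × Anc c v)
  child-toward anc-refl x≢x = ⊥-elim (x≢x refl)
  child-toward {x} (anc-step {v} v≢r xp) _ with x ≟ parent v
  ... | yes x≡p = v , v≢r , sym x≡p , anc-refl
  ... | no x≢p with child-toward xp x≢p
  ...   | c , c≢r , pc≡x , cp = c , c≢r , pc≡x , anc-step v≢r cp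

  Anc-edge-endpoint : ∀ {c c′ w} → c′ ≢ root → w ≡ c′ ⊎ w ≡ parent c′ → Anc c w → Anc c c′
  Anc-edge-endpoint _    (inj₁ refl) cw = cw
  Anc-edge-endpoint c′≢r (inj₂ refl) cw = anc-step c′≢r cw

  module _ {p q} (C : LowestCommonAnc p q) where
    open LowestCommonAnc C

    ProperAnc-lca⇒¬Anc-both : ∀ {c} → ProperAnc lca c → ¬ (Anc c p × Anc c q)
    ProperAnc-lca⇒¬Anc-both lca-c (cp , cq) = ProperAnc⇒¬Anc lca-c (lca-max _ cp cq)

    lca-ProperAnc : ∀ {c} → Anc c p ⊎ Anc c q → ¬ (Anc c p × Anc c q) → ProperAnc lca c
    lca-ProperAnc (inj₁ cp) ¬both with Anc-total lca-anc₁ cp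
    ... | inj₁ lca-c = Anc∧≢⇒ProperAnc lca-c (λ { refl → ¬both (cp , lca-anc₂) })
    ... | inj₂ c-lca = ⊥-elim (¬both (cp , Anc-trans c-lca lca-anc₂))
    lca-ProperAnc (inj₂ cq) ¬both with Anc-total lca-anc₂ cq
    ... | inj₁ lca-c = Anc∧≢⇒ProperAnc lca-c (λ { refl → ¬both (lca-anc₁ , cq) })
    ... | inj₂ c-lca = ⊥-elim (¬both (Anc-trans c-lca lca-anc₁ , cq))

  apex : Fin m → Fin n
  apex ℓ = LowestCommonAnc.lca (lowestCommonAnc (a ℓ) (b ℓ))

  module _ (ℓ : Fin m) where
    private
      C = lowestCommonAnc (a ℓ) (b ℓ)
    open LowestCommonAnc C

    P⇒apex-ProperAnc : ∀ {c} → P ℓ c → ProperAnc (apex ℓ) c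
    P⇒apex-ProperAnc (_ , c-ab , ¬both) = lca-ProperAnc C c-ab ¬both

    P-intro : ∀ {c} → ProperAnc (apex ℓ) c → Anc c (a ℓ) ⊎ Anc c (b ℓ) → P ℓ c
    P-intro apex-c c-ab = proj₁ apex-c , c-ab , ProperAnc-lca⇒¬Anc-both C apex-c

    P⇒V : ∀ {c} → P ℓ c → V ℓ c
    P⇒V {c} Pc = c , Pc , inj₁ refl

    V⇒apex-Anc : ∀ {w} → V ℓ w → Anc (apex ℓ) w
    V⇒apex-Anc (c , Pc , inj₁ refl) = ProperAnc⇒Anc (P⇒apex-ProperAnc Pc)
    V⇒apex-Anc (c , Pc , inj₂ refl) = proj₂ (P⇒apex-ProperAnc Pc)

    P-above-V : ∀ {w c} → V ℓ w → ProperAnc (apex ℓ) c → Anc c w → P ℓ c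
    P-above-V (c′ , (c′≢r , c′-ab , _) , w≡) apex-c cw with Anc-edge-endpoint c′≢r w≡ cw
    ... | cc′ = P-intro apex-c (⊎-map (Anc-trans cc′) (Anc-trans cc′) c′-ab)

    P-between : ∀ {c₁ c₂ c} → P ℓ c₁ → P ℓ c₂ → Anc c₁ c → Anc c c₂ → P ℓ c
    P-between Pc₁ Pc₂ c₁c cc₂ = P-above-V (P⇒V Pc₂) (ProperAnc-transʳ (P⇒apex-ProperAnc Pc₁) c₁c) cc₂

    apex∈V-toward : ∀ {e} → Anc lca e → lca ≢ e →
      (∀ {c} → Anc c e → Anc c (a ℓ) ⊎ Anc c (b ℓ)) → V ℓ lca
    apex∈V-toward lca-e lca≢e toward-ab with child-toward lca-e lca≢e
    ... | c , c≢r , pc≡lca , ce =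
      c , P-intro (c≢r , subst (Anc lca) (sym pc≡lca) anc-refl) (toward-ab ce) , inj₂ (sym pc≡lca)

    apex∈V : V ℓ (apex ℓ)
    apex∈V with lca ≟ a ℓ
    ... | no lca≢a  = apex∈V-toward lca-anc₁ lca≢a inj₁
    ... | yes lca≡a = apex∈V-toward lca-anc₂ (λ lca≡b → distinct ℓ (trans (sym lca≡a) lca≡b)) inj₂

    apex-IsApex : IsApex ℓ (apex ℓ)
    apex-IsApex = apex∈V , λ _ Vw → Anc⇒depth-≤ (V⇒apex-Anc Vw)

    IsApex⇒≡apex : ∀ {w} → IsApex ℓ w → w ≡ apex ℓ
    IsApex⇒≡apex (Vw , w-min) =
      sym (Anc-depth-≡⇒≡ (V⇒apex-Anc Vw) (≤-antisym (Anc⇒depth-≤ (V⇒apex-Anc Vw)) (w-min _ apex∈V)))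

  lower-end : ∀ {u} → UpLink u → Fin n
  lower-end {u} (inj₁ _) = b u
  lower-end {u} (inj₂ _) = a u

  P-up⇒Anc-lower-end : ∀ {u c} (up : UpLink u) → P u c → Anc c (lower-end up)
  P-up⇒Anc-lower-end (inj₁ ab) (_ , inj₁ ca , _) = Anc-trans ca ab
  P-up⇒Anc-lower-end (inj₁ _)  (_ , inj₂ cb , _) = cb
  P-up⇒Anc-lower-end (inj₂ _)  (_ , inj₁ ca , _) = ca
  P-up⇒Anc-lower-end (inj₂ ba) (_ , inj₂ cb , _) = Anc-trans cb ba

  P-up-total : ∀ {u c₁ c₂} → UpLink u → P u c₁ → P u c₂ → Anc c₁ c₂ ⊎ Anc c₂ c₁
  P-up-total up Pc₁ Pc₂ = Anc-total (P-up⇒Anc-lower-end up Pc₁) (P-up⇒Anc-lower-end up Pc₂)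

  Top⇒≡apex : ∀ {u t} → Top u t → t ≡ apex u
  Top⇒≡apex {u} (inj₁ (refl , ab)) = Anc-antisym (lca-max _ anc-refl ab) lca-anc₁
    where open LowestCommonAnc (lowestCommonAnc (a u) (b u))
  Top⇒≡apex {u} (inj₂ (refl , ba)) = Anc-antisym (lca-max _ ba anc-refl) lca-anc₂
    where open LowestCommonAnc (lowestCommonAnc (a u) (b u))

  P? : ∀ ℓ c → Dec (P ℓ c)
  P? ℓ c = ¬? (c ≟ root) ×-dec (Anc? c (a ℓ) ⊎-dec Anc? c (b ℓ))
                        ×-dec ¬? (Anc? c (a ℓ) ×-dec Anc? c (b ℓ))

  module DependencyGraph
      (F : Fin m → Set) (U : Fin m → Set) (U-up : ∀ u → U u → UpLink u)
      (U-disjoint : ∀ u u′ → U u → U u′ → u ≢ u′ → ∀ c → ¬ (P u c × P u′ c))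
      (Fu : Fin m → Fin m → Set) (valid : WithF.WithU.ValidChoice F U Fu) where
    open WithF F
    open WithU U Fu

    B-intro : ∀ {v x} → F x → Anc v (apex x) → B v x
    B-intro {x = x} Fx v-apex = Fx , apex x , apex-IsApex x , v-apex

    Fu⇒F : ∀ {u x} → U u → Fu u x → F x
    Fu⇒F {u} {x} Uu Fux with valid u Uu
    ... | _ , _ , Fu⊆B , _ = proj₁ (Fu⊆B x Fux)

    Fu-covers : ∀ {u} → U u → Covers (Fu u) u
    Fu-covers {u} Uu with valid u Uu
    ... | _ , _ , _ , covers , _ = covers

    Pu⇒P : ∀ {u x c} → U u → Pu u x c → P x c
    Pu⇒P {x = x} Uu (Puc , only-x) with Fu-covers Uu _ Puc
    ... | y , Fuy , Pyc with y ≟ x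
    ...   | yes refl = Pyc
    ...   | no y≢x   = ⊥-elim (only-x y Fuy y≢x Pyc)

    -- otherwise F_u ∖ {x} would still cover P_u, against the minimality of F_u
    Pu-inhabited : ∀ {u x} → U u → Fu u x → DoubleNegation (∃ (Pu u x))
    Pu-inhabited {u} {x} Uu Fux no-private with valid u Uu
    ... | _ , _ , _ , covers , minimal =
      ¬¬-∀-Fin (λ c → ¬¬-→ (covered-without-x c)) λ covers′ →
        proj₂ (minimal (λ y → Fu u y × y ≢ x) (λ _ → proj₁) covers′ x Fux) refl
      where
        covered-without-x : ∀ c → P u c → DoubleNegation (∃[ y ] ((Fu u y × y ≢ x) × P y c))
        covered-without-x c Puc k with covers c Puc
        ... | y , Fuy , Pyc with y ≟ x
        ...   | no y≢x   = k (y , (Fuy , y≢x) , Pyc)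
        ...   | yes refl = no-private (c , Puc , λ y′ Fuy′ y′≢x Py′c → k (y′ , (Fuy′ , y′≢x) , Py′c))

    ≺-stable : ∀ {u x y} → DoubleNegation (Prec u x y) → Prec u x y
    ≺-stable x≺y c₁ c₂ Pu-c₁ Pu-c₂ =
      decidable-stable (depth c₁ <? depth c₂) (¬¬-map (λ x≺y → x≺y c₁ c₂ Pu-c₁ Pu-c₂) x≺y)

    ≺-from-private : ∀ {u x y dx dy} → U u → Fu u x → Fu u y → x ≢ y →
      Pu u x dx → Pu u y dy → Anc dx dy → Prec u x y
    ≺-from-private {u} {x} {y} {dx} {dy} Uu Fux Fuy x≢y Pu-dx Pu-dy dx-dy c₁ c₂ Pu-c₁ Pu-c₂
      with P-up-total (U-up u Uu) (proj₁ Pu-c₁) (proj₁ Pu-c₂)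
    ... | inj₁ c₁c₂ = ProperAnc⇒depth-<
      (Anc∧≢⇒ProperAnc c₁c₂ λ { refl → proj₂ Pu-c₁ y Fuy (≢-sym x≢y) (Pu⇒P Uu Pu-c₂) })
    ... | inj₂ c₂c₁ with P-up-total (U-up u Uu) (proj₁ Pu-c₁) (proj₁ Pu-dy)
    ...   | inj₁ c₁dy = ⊥-elim (proj₂ Pu-c₁ y Fuy (≢-sym x≢y)
                          (P-between y (Pu⇒P Uu Pu-c₂) (Pu⇒P Uu Pu-dy) c₂c₁ c₁dy))
    ...   | inj₂ dyc₁ = ⊥-elim (proj₂ Pu-dy x Fux x≢y
                          (P-between x (Pu⇒P Uu Pu-dx) (Pu⇒P Uu Pu-c₁) dx-dy dyc₁))

    ≺-total : ∀ {u x y} → U u → Fu u x → Fu u y → x ≢ y →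
      DoubleNegation (Prec u x y ⊎ Prec u y x)
    ≺-total {u} Uu Fux Fuy x≢y = do
      (dx , Pu-dx) ← Pu-inhabited Uu Fux
      (dy , Pu-dy) ← Pu-inhabited Uu Fuy
      pure (⊎-map (≺-from-private Uu Fux Fuy x≢y Pu-dx Pu-dy)
                         (≺-from-private Uu Fuy Fux (≢-sym x≢y) Pu-dy Pu-dx)
                         (P-up-total (U-up u Uu) (proj₁ Pu-dx) (proj₁ Pu-dy)))

    ≺⇒Anc : ∀ {u x y c₁ c₂} → U u → Prec u x y → Pu u x c₁ → Pu u y c₂ → Anc c₁ c₂
    ≺⇒Anc {u} Uu x≺y Pu-c₁ Pu-c₂ with P-up-total (U-up u Uu) (proj₁ Pu-c₁) (proj₁ Pu-c₂)
    ... | inj₁ c₁c₂ = c₁c₂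
    ... | inj₂ c₂c₁ = ⊥-elim (<-irrefl refl (≤-<-trans (Anc⇒depth-≤ c₂c₁) (x≺y _ _ Pu-c₁ Pu-c₂)))

    ≺-trans : ∀ {u x y z} → U u → Fu u y → Prec u x y → Prec u y z → Prec u x z
    ≺-trans Uu Fuy x≺y y≺z = ≺-stable do
      (d , Pu-d) ← Pu-inhabited Uu Fuy
      pure λ _ _ Pu-c₁ Pu-c₃ → <-trans (x≺y _ _ Pu-c₁ Pu-d) (y≺z _ _ Pu-d Pu-c₃)

    ≺⇒≢ : ∀ {u x y} → U u → Fu u x → Prec u x y → x ≢ y
    ≺⇒≢ Uu Fux x≺x refl = Pu-inhabited Uu Fux λ (d , Pu-d) → <-irrefl refl (x≺x d d Pu-d Pu-d)

    module _ {u x y} (arc : Arc u x y) where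
      Arc⇒U : U u
      Arc⇒U = proj₁ arc

      Arc⇒Fu₁ : Fu u x
      Arc⇒Fu₁ = proj₁ (proj₂ arc)

      Arc⇒Fu₂ : Fu u y
      Arc⇒Fu₂ = proj₁ (proj₂ (proj₂ arc))

      Arc⇒≺ : Prec u x y
      Arc⇒≺ = proj₁ (proj₂ (proj₂ (proj₂ arc)))

      Arc⇒consecutive : ¬ (∃[ z ] (Fu u z × Prec u x z × Prec u z y))
      Arc⇒consecutive = proj₂ (proj₂ (proj₂ (proj₂ arc)))

      Arc⇒≢ : x ≢ y
      Arc⇒≢ = ≺⇒≢ Arc⇒U Arc⇒Fu₁ Arc⇒≺

    Pu-Anc-P⇒Anc-apex : ∀ {u x y dx c} → Pu u x dx → Fu u y → y ≢ x → P y c → Anc dx c → Anc dx (apex y)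
    Pu-Anc-P⇒Anc-apex {y = y} Pu-dx Fuy y≢x Pyc dx-c
      with Anc-trichotomy (ProperAnc⇒Anc (P⇒apex-ProperAnc y Pyc)) dx-c
    ... | inj₁ refl           = anc-refl
    ... | inj₂ (inj₁ apex-dx) = ⊥-elim (proj₂ Pu-dx y Fuy y≢x (P-above-V y (P⇒V y Pyc) apex-dx dx-c))
    ... | inj₂ (inj₂ dx-apex) = ProperAnc⇒Anc dx-apex

    module _ {u x y dx dy} (arc : Arc u x y) (Pu-dx : Pu u x dx) (Pu-dy : Pu u y dy) where
      private
        Uu = Arc⇒U arc

      private-Anc-apex : Anc dx (apex y)
      private-Anc-apex = Pu-Anc-P⇒Anc-apex Pu-dx (Arc⇒Fu₂ arc) (≢-sym (Arc⇒≢ arc))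
        (Pu⇒P Uu Pu-dy) (≺⇒Anc Uu (Arc⇒≺ arc) Pu-dx Pu-dy)

      apex-Anc-private : Anc (apex y) dy
      apex-Anc-private = ProperAnc⇒Anc (P⇒apex-ProperAnc y (Pu⇒P Uu Pu-dy))

      apex∈Pu : P u (apex y)
      apex∈Pu = P-between u (proj₁ Pu-dx) (proj₁ Pu-dy) private-Anc-apex apex-Anc-private

      -- a link of F_u other than x covering apex y would sit before x or after y in ≺_u
      Fu-covering-apex≡tail : ∀ {z} → Fu u z → P z (apex y) → z ≡ x
      Fu-covering-apex≡tail {z} Fuz Pz = decidable-stable (z ≟ x) λ z≢x → case z ≟ y of λ where
        (yes refl) → ProperAnc-irrefl (P⇒apex-ProperAnc y Pz)
        (no z≢y)   → ≺-total Uu Fuz (Arc⇒Fu₁ arc) z≢x λ where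
          (inj₁ z≺x) → Pu-inhabited Uu Fuz λ (dz , Pu-dz) → proj₂ Pu-dx z Fuz z≢x
            (P-between z (Pu⇒P Uu Pu-dz) Pz (≺⇒Anc Uu z≺x Pu-dz Pu-dx) private-Anc-apex)
          (inj₂ x≺z) → ≺-total Uu Fuz (Arc⇒Fu₂ arc) z≢y λ where
            (inj₁ z≺y) → Arc⇒consecutive arc (z , Fuz , x≺z , z≺y)
            (inj₂ y≺z) → Pu-inhabited Uu Fuz λ (dz , Pu-dz) → proj₂ Pu-dy z Fuz z≢y
              (P-between z Pz (Pu⇒P Uu Pu-dz) apex-Anc-private (≺⇒Anc Uu y≺z Pu-dy Pu-dz))

      apex∈P-tail : P x (apex y)
      apex∈P-tail with Fu-covers Uu (apex y) apex∈Pu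
      ... | z , Fuz , Pz = subst (λ z → P z (apex y)) (Fu-covering-apex≡tail Fuz Pz) Pz

    Arc⇒P-apex : ∀ {u x y} → Arc u x y → P u (apex y) × P x (apex y)
    Arc⇒P-apex {u} {x} {y} arc = decidable-stable (P? u (apex y) ×-dec P? x (apex y)) do
      (dx , Pu-dx) ← Pu-inhabited (Arc⇒U arc) (Arc⇒Fu₁ arc)
      (dy , Pu-dy) ← Pu-inhabited (Arc⇒U arc) (Arc⇒Fu₂ arc)
      pure (apex∈Pu arc Pu-dx Pu-dy , apex∈P-tail arc Pu-dx Pu-dy)

    Arc⇒apex-ProperAnc : ∀ {u x y} → Arc u x y → ProperAnc (apex x) (apex y)
    Arc⇒apex-ProperAnc {x = x} arc = P⇒apex-ProperAnc x (proj₂ (Arc⇒P-apex arc))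

    DPath⇒apex-Anc : ∀ {x y} → DPath x y → Anc (apex x) (apex y)
    DPath⇒apex-Anc []             = anc-refl
    DPath⇒apex-Anc (step _ arc p) =
      Anc-trans (ProperAnc⇒Anc (Arc⇒apex-ProperAnc arc)) (DPath⇒apex-Anc p)

    Arc-head-unique : ∀ {u x y y′} → Arc u x y → Arc u x y′ → y ≡ y′
    Arc-head-unique {y = y} {y′} arc arc′ = decidable-stable (y ≟ y′) λ y≢y′ →
      ≺-total (Arc⇒U arc) (Arc⇒Fu₂ arc) (Arc⇒Fu₂ arc′) y≢y′ λ where
        (inj₁ y≺y′) → Arc⇒consecutive arc′ (y , Arc⇒Fu₂ arc , Arc⇒≺ arc , y≺y′)
        (inj₂ y′≺y) → Arc⇒consecutive arc (y′ , Arc⇒Fu₂ arc′ , Arc⇒≺ arc′ , y′≺y)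

    Arc-tail-unique : ∀ {u u′ x x′ y} → Arc u x y → Arc u′ x′ y → x ≡ x′
    Arc-tail-unique {u} {u′} {x} {x′} {y} arc arc′ with u ≟ u′
    ... | no u≢u′ = ⊥-elim (U-disjoint u u′ (Arc⇒U arc) (Arc⇒U arc′) u≢u′ (apex y)
                      (proj₁ (Arc⇒P-apex arc) , proj₁ (Arc⇒P-apex arc′)))
    ... | yes refl = decidable-stable (x ≟ x′) λ x≢x′ →
      ≺-total (Arc⇒U arc) (Arc⇒Fu₁ arc) (Arc⇒Fu₁ arc′) x≢x′ λ where
        (inj₁ x≺x′) → Arc⇒consecutive arc (x′ , Arc⇒Fu₁ arc′ , x≺x′ , Arc⇒≺ arc′)
        (inj₂ x′≺x) → Arc⇒consecutive arc′ (x , Arc⇒Fu₁ arc , x′≺x , Arc⇒≺ arc)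

    DPath-snoc : ∀ {u x y z} → DPath x y → Arc u y z → DPath x z
    DPath-snoc []             arc′ = step _ arc′ []
    DPath-snoc (step u arc p) arc′ = step u arc (DPath-snoc p arc′)

    DPath-unsnoc : ∀ {x y} → DPath x y → x ≡ y ⊎ ∃[ z ] ∃[ u ] (DPath x z × Arc u z y)
    DPath-unsnoc [] = inj₁ refl
    DPath-unsnoc (step u arc p) with DPath-unsnoc p
    ... | inj₁ refl               = inj₂ (_ , u , [] , arc)
    ... | inj₂ (z , u′ , q , arc′) = inj₂ (z , u′ , step u arc q , arc′)

    -- in-degrees are at most one, so walking back along a weak path stays on the path from ρ
    Conn⇒DPath : ∀ {ρ x y} → (∀ u x → ¬ Arc u x ρ) → DPath ρ x → Conn x y → DPath ρ y
    Conn⇒DPath ρ-source p conn-refl              = p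
    Conn⇒DPath ρ-source p (conn-fwd u arc x~y)   = Conn⇒DPath ρ-source (DPath-snoc p arc) x~y
    Conn⇒DPath ρ-source p (conn-bwd u arc x~y) with DPath-unsnoc p
    ... | inj₁ refl               = ⊥-elim (ρ-source u _ arc)
    ... | inj₂ (z , u′ , q , arc′) with Arc-tail-unique arc arc′
    ...   | refl = Conn⇒DPath ρ-source q x~y

    DPath-covers : ∀ {x w v c} → DPath x w → F x → V w v → ProperAnc (apex x) c → Anc c v →
      ∃[ z ] (F z × P z c × Anc (apex x) (apex z))
    DPath-covers {x} [] Fx Vv x-c cv = x , Fx , P-above-V x Vv x-c cv , anc-refl
    DPath-covers {x} {w} {c = c} (step {y = y} u arc p) Fx Vv x-c cv with Anc? c (apex y)
    ... | yes c-y = x , Fx , P-above-V x (P⇒V x (proj₂ (Arc⇒P-apex arc))) x-c c-y , anc-refl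
    ... | no ¬c-y with Anc-total cv (Anc-trans (DPath⇒apex-Anc p) (V⇒apex-Anc w Vv))
    ...   | inj₁ c-y = ⊥-elim (¬c-y c-y)
    ...   | inj₂ y-c with DPath-covers p (Fu⇒F (Arc⇒U arc) (Arc⇒Fu₂ arc)) Vv
                            (Anc∧≢⇒ProperAnc y-c λ { refl → ¬c-y anc-refl }) cv
    ...     | z , Fz , Pzc , y-z = z , Fz , Pzc , Anc-trans (ProperAnc⇒Anc (Arc⇒apex-ProperAnc arc)) y-z

    -- B (apex y) covers P u′, so v_{u′} lies at least as deep as apex y; yet x ∈ B v_{u′},
    -- so v_{u′} is an ancestor of apex x, which lies strictly above apex y.
    module Fork {u u′ x y z w v} (arc : Arc u x y) (arc′ : Arc u′ x z) (u≢u′ : u ≢ u′)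
                (y-z : ProperAnc (apex y) (apex z)) (p : DPath y w) (Vv : V w v) (z-v : Anc (apex z) v) where
      private
        Uu′ = Arc⇒U arc′
        Fuz = Arc⇒Fu₂ arc′
        Pu′-z = proj₁ (Arc⇒P-apex arc′)

      apex-y-Anc-apex-u′ : Anc (apex y) (apex u′)
      apex-y-Anc-apex-u′
        with Anc-trichotomy (ProperAnc⇒Anc y-z) (ProperAnc⇒Anc (P⇒apex-ProperAnc u′ Pu′-z))
      ... | inj₁ y≡u′         = subst (Anc (apex y)) y≡u′ anc-refl
      ... | inj₂ (inj₁ y-u′)  = ProperAnc⇒Anc y-u′
      ... | inj₂ (inj₂ u′-y)  = ⊥-elim (U-disjoint u u′ (Arc⇒U arc) Uu′ u≢u′ (apex y)
          (proj₁ (Arc⇒P-apex arc) , P-above-V u′ (P⇒V u′ Pu′-z) u′-y (ProperAnc⇒Anc y-z)))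

      module _ {dz} (Pu-dz : Pu u′ z dz) where
        Fu-above-y-⊥ : ∀ {ℓ c} → Fu u′ ℓ → P ℓ c → ProperAnc (apex z) c → Anc dz c →
          Anc (apex ℓ) (apex y) → ⊥
        Fu-above-y-⊥ {ℓ} Fuℓ Pℓc z-c dz-c ℓ-y = proj₂ Pu-dz ℓ Fuℓ ℓ≢z
          (P-above-V ℓ (P⇒V ℓ Pℓc) (ProperAnc-transˡ (Anc-trans ℓ-y (ProperAnc⇒Anc y-z)) z-dz) dz-c)
          where
            z-dz = P⇒apex-ProperAnc z (Pu⇒P Uu′ Pu-dz)
            ℓ≢z : ℓ ≢ z
            ℓ≢z refl = ProperAnc⇒¬Anc y-z ℓ-y

        covers-below-z : ∀ {c} → P u′ c → ProperAnc (apex z) c → ∃[ ℓ ] (B (apex y) ℓ × P ℓ c)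
        covers-below-z {c} Pu′c z-c with Anc? c dz
        ... | yes c-dz = z , B-intro (Fu⇒F Uu′ Fuz) (ProperAnc⇒Anc y-z) ,
                         P-above-V z (P⇒V z (Pu⇒P Uu′ Pu-dz)) z-c c-dz
        ... | no ¬c-dz with Fu-covers Uu′ c Pu′c
        ...   | ℓ , Fuℓ , Pℓc with Anc-total (ProperAnc⇒Anc (P⇒apex-ProperAnc ℓ Pℓc))
                                            (Anc-trans (ProperAnc⇒Anc y-z) (ProperAnc⇒Anc z-c))
        ...     | inj₂ y-ℓ = ℓ , B-intro (Fu⇒F Uu′ Fuℓ) y-ℓ , Pℓc
        ...     | inj₁ ℓ-y with P-up-total (U-up u′ Uu′) (proj₁ Pu-dz) Pu′c
        ...       | inj₁ dz-c = ⊥-elim (Fu-above-y-⊥ Fuℓ Pℓc z-c dz-c ℓ-y)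
        ...       | inj₂ c-dz = ⊥-elim (¬c-dz c-dz)

        B-covers : Covers (B (apex y)) u′
        B-covers c Pu′c with Anc? c (apex z)
        ... | yes c-z with DPath-covers p (Fu⇒F (Arc⇒U arc) (Arc⇒Fu₂ arc)) Vv
                             (ProperAnc-transˡ apex-y-Anc-apex-u′ (P⇒apex-ProperAnc u′ Pu′c))
                             (Anc-trans c-z z-v)
        ...   | ℓ , Fℓ , Pℓc , y-ℓ = ℓ , B-intro Fℓ y-ℓ , Pℓc
        B-covers c Pu′c | no ¬c-z with P-up-total (U-up u′ Uu′) Pu′c Pu′-z
        ...   | inj₁ c-z = ⊥-elim (¬c-z c-z)
        ...   | inj₂ z-c = covers-below-z Pu′c (Anc∧≢⇒ProperAnc z-c λ { refl → ¬c-z anc-refl })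

      vu-too-deep : Covers (B (apex y)) u′ → ⊥
      vu-too-deep covers with valid u′ Uu′
      ... | v′ , (t , top , _ , _ , maximal) , Fu⊆B , _ with Fu⊆B x (Arc⇒Fu₁ arc′)
      ...   | _ , w′ , w′-apex , v′-w′ = <-irrefl refl (≤-<-trans y≤v′ (≤-<-trans v′≤x x<y))
        where
          y≤v′ = maximal (apex y) (subst (Anc (apex y)) (sym (Top⇒≡apex top)) apex-y-Anc-apex-u′) covers
          v′≤x = Anc⇒depth-≤ (subst (Anc v′) (IsApex⇒≡apex x w′-apex) v′-w′)
          x<y  = ProperAnc⇒depth-< (Arc⇒apex-ProperAnc arc)

      fork-⊥ : ⊥
      fork-⊥ = Pu-inhabited Uu′ Fuz λ (dz , Pu-dz) → vu-too-deep (B-covers Pu-dz)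

    diverging-paths-⊥ : ∀ {u u′ x y z ℓ ℓ̄} → Arc u x y → Arc u′ x z → y ≢ z →
      DPath y ℓ → DPath z ℓ̄ → V ℓ̄ (apex ℓ) → ⊥
    diverging-paths-⊥ {u} {u′} {y = y} {z} {ℓ} {ℓ̄} arc arc′ y≢z p q Vℓ̄ with u ≟ u′
    ... | yes refl = y≢z (Arc-head-unique arc arc′)
    ... | no u≢u′ = by-apexes (DPath⇒apex-Anc p) (Anc-trans (DPath⇒apex-Anc q) (V⇒apex-Anc ℓ̄ Vℓ̄))
      where
        by-apexes : Anc (apex y) (apex ℓ) → Anc (apex z) (apex ℓ) → ⊥
        by-apexes y-ℓ z-ℓ with Anc-trichotomy y-ℓ z-ℓ
        ... | inj₁ y≡z = U-disjoint u u′ (Arc⇒U arc) (Arc⇒U arc′) u≢u′ (apex y)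
                (proj₁ (Arc⇒P-apex arc) , subst (P u′) (sym y≡z) (proj₁ (Arc⇒P-apex arc′)))
        ... | inj₂ (inj₁ y-z) = Fork.fork-⊥ arc arc′ u≢u′ y-z p (apex∈V ℓ) z-ℓ
        ... | inj₂ (inj₂ z-y) = Fork.fork-⊥ arc′ arc (≢-sym u≢u′) z-y q Vℓ̄ y-ℓ

    data ArcFrom : ∀ {x y} → DPath x y → Fin m → Fin m → Set where
      arc-here  : ∀ {x y z u} (arc : Arc u x y) (p : DPath y z) → ArcFrom (step u arc p) x u
      arc-there : ∀ {x y z u x′ u′} (arc : Arc u x y) (p : DPath y z) →
                  ArcFrom p x′ u′ → ArcFrom (step u arc p) x′ u′

    ArcFrom⇒UsesLabel : ∀ {x y x′ u} {H : DPath x y} → ArcFrom H x′ u → UsesLabel H u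
    ArcFrom⇒UsesLabel (arc-here arc p)       = here arc p
    ArcFrom⇒UsesLabel (arc-there arc p from) = there arc p (ArcFrom⇒UsesLabel from)

    ArcFrom⇒U : ∀ {x y x′ u} {H : DPath x y} → ArcFrom H x′ u → U u
    ArcFrom⇒U (arc-here arc _)       = Arc⇒U arc
    ArcFrom⇒U (arc-there _ _ from) = ArcFrom⇒U from

    ArcFrom⇒Arc : ∀ {x y x′ u} {H : DPath x y} → ArcFrom H x′ u → ∃[ w ] (Arc u x′ w × DPath w y)
    ArcFrom⇒Arc (arc-here arc p)      = _ , arc , p
    ArcFrom⇒Arc (arc-there _ _ from) = ArcFrom⇒Arc from

    DPath-through : ∀ {x ℓ ℓ̄} (H : DPath x ℓ) → DPath x ℓ̄ → ℓ̄ ≢ ℓ → V ℓ̄ (apex ℓ) →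
      ∃[ u ] ArcFrom H ℓ̄ u
    DPath-through []             []   ℓ̄≢ℓ _ = ⊥-elim (ℓ̄≢ℓ refl)
    DPath-through (step u arc H) []   _   _ = u , arc-here arc H
    DPath-through {ℓ̄ = ℓ̄} [] (step u arc G) _ Vℓ̄ =
      ⊥-elim (ProperAnc⇒¬Anc (Arc⇒apex-ProperAnc arc) (Anc-trans (DPath⇒apex-Anc G) (V⇒apex-Anc ℓ̄ Vℓ̄)))
    DPath-through (step {y = y} u arc H) (step {y = z} u′ arc′ G) ℓ̄≢ℓ Vℓ̄ with y ≟ z
    ... | yes refl = map₂ (arc-there arc H) (DPath-through H G ℓ̄≢ℓ Vℓ̄)
    ... | no y≢z   = ⊥-elim (diverging-paths-⊥ arc arc′ y≢z H G Vℓ̄)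

    Arc-≺-mono : ∀ {u x₁ x₂ w₁ w₂} → Arc u x₁ w₁ → Arc u x₂ w₂ → Prec u x₁ x₂ → Prec u w₁ w₂
    Arc-≺-mono {x₂ = x₂} {w₁} arc₁ arc₂ x₁≺x₂ with w₁ ≟ x₂
    ... | yes refl  = Arc⇒≺ arc₂
    ... | no w₁≢x₂ = ≺-stable λ ¬w₁≺w₂ →
      ≺-total (Arc⇒U arc₁) (Arc⇒Fu₂ arc₁) (Arc⇒Fu₁ arc₂) w₁≢x₂ λ where
        (inj₁ w₁≺x₂) → ¬w₁≺w₂ (≺-trans (Arc⇒U arc₁) (Arc⇒Fu₁ arc₂) w₁≺x₂ (Arc⇒≺ arc₂))
        (inj₂ x₂≺w₁) → Arc⇒consecutive arc₁ (x₂ , Arc⇒Fu₁ arc₂ , x₁≺x₂ , x₂≺w₁)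

    module Ordered {u x₁ x₂ w₁ w₂ ℓ d₁ e₁ e₂} (arc₁ : Arc u x₁ w₁) (arc₂ : Arc u x₂ w₂)
                   (x₁≺x₂ : Prec u x₁ x₂) (Vx₁ : V x₁ (apex ℓ)) (w₂-ℓ : Anc (apex w₂) (apex ℓ))
                   (Pu-d₁ : Pu u x₁ d₁) (Pu-e₁ : Pu u w₁ e₁) (Pu-e₂ : Pu u w₂ e₂) where
      private
        Uu  = Arc⇒U arc₁
        Fx₁ = Arc⇒Fu₁ arc₁
        Fw₁ = Arc⇒Fu₂ arc₁
        Fw₂ = Arc⇒Fu₂ arc₂
        w₁≺w₂ = Arc-≺-mono arc₁ arc₂ x₁≺x₂
        d₁-e₁ = ≺⇒Anc Uu (Arc⇒≺ arc₁) Pu-d₁ Pu-e₁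
        e₁-e₂ = ≺⇒Anc Uu w₁≺w₂ Pu-e₁ Pu-e₂
        Vw₂-e₂ = P⇒V w₂ (Pu⇒P Uu Pu-e₂)

      apex-w₂-above-⊥ : Anc (apex w₂) (apex x₁) → ⊥
      apex-w₂-above-⊥ w₂-x₁ = proj₂ Pu-d₁ w₂ Fw₂ (≢-sym (≺⇒≢ Uu Fx₁ (≺-trans Uu Fw₁ (Arc⇒≺ arc₁) w₁≺w₂)))
        (P-above-V w₂ Vw₂-e₂ (ProperAnc-transˡ w₂-x₁ (P⇒apex-ProperAnc x₁ (Pu⇒P Uu Pu-d₁)))
                             (Anc-trans d₁-e₁ e₁-e₂))

      apex-x₁-above-⊥ : ProperAnc (apex x₁) (apex w₂) → ⊥
      apex-x₁-above-⊥ x₁-w₂ with Anc? e₁ (apex w₂)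
      ... | yes e₁-w₂ = proj₂ Pu-e₁ x₁ Fx₁ (Arc⇒≢ arc₁)
          (P-between x₁ (Pu⇒P Uu Pu-d₁) (P-above-V x₁ Vx₁ x₁-w₂ w₂-ℓ) d₁-e₁ e₁-w₂)
      ... | no ¬e₁-w₂ with P-up-total (U-up u Uu) (proj₁ Pu-e₁) (proj₁ (Arc⇒P-apex arc₂))
      ...   | inj₁ e₁-w₂ = ¬e₁-w₂ e₁-w₂
      ...   | inj₂ w₂-e₁ = proj₂ Pu-e₁ w₂ Fw₂ (≢-sym (≺⇒≢ Uu Fw₁ w₁≺w₂))
          (P-above-V w₂ Vw₂-e₂ (Anc∧≢⇒ProperAnc w₂-e₁ λ { refl → ¬e₁-w₂ anc-refl }) e₁-e₂)

      ordered-⊥ : ⊥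
      ordered-⊥ with Anc-trichotomy (V⇒apex-Anc x₁ Vx₁) w₂-ℓ
      ... | inj₁ x₁≡w₂         = apex-w₂-above-⊥ (subst (λ v → Anc v (apex x₁)) x₁≡w₂ anc-refl)
      ... | inj₂ (inj₁ x₁-w₂)  = apex-x₁-above-⊥ x₁-w₂
      ... | inj₂ (inj₂ w₂-x₁)  = apex-w₂-above-⊥ (ProperAnc⇒Anc w₂-x₁)

    ordered-arcs-⊥ : ∀ {u x₁ x₂ w₁ w₂ ℓ} → Arc u x₁ w₁ → Arc u x₂ w₂ → Prec u x₁ x₂ →
      V x₁ (apex ℓ) → Anc (apex w₂) (apex ℓ) → ⊥
    ordered-arcs-⊥ arc₁ arc₂ x₁≺x₂ Vx₁ w₂-ℓ =
      Pu-inhabited (Arc⇒U arc₁) (Arc⇒Fu₁ arc₁) λ (_ , Pu-d₁) →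
      Pu-inhabited (Arc⇒U arc₁) (Arc⇒Fu₂ arc₁) λ (_ , Pu-e₁) →
      Pu-inhabited (Arc⇒U arc₂) (Arc⇒Fu₂ arc₂) λ (_ , Pu-e₂) →
      Ordered.ordered-⊥ arc₁ arc₂ x₁≺x₂ Vx₁ w₂-ℓ Pu-d₁ Pu-e₁ Pu-e₂

    ArcFrom-injective : ∀ {ρ ℓ x₁ x₂ u} {H : DPath ρ ℓ} → ArcFrom H x₁ u → ArcFrom H x₂ u →
      V x₁ (apex ℓ) → V x₂ (apex ℓ) → x₁ ≡ x₂
    ArcFrom-injective {x₁ = x₁} {x₂} from₁ from₂ Vx₁ Vx₂ with ArcFrom⇒Arc from₁ | ArcFrom⇒Arc from₂
    ... | _ , arc₁ , p₁ | _ , arc₂ , p₂ = decidable-stable (x₁ ≟ x₂) λ x₁≢x₂ →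
      ≺-total (Arc⇒U arc₁) (Arc⇒Fu₁ arc₁) (Arc⇒Fu₁ arc₂) x₁≢x₂ λ where
        (inj₁ x₁≺x₂) → ordered-arcs-⊥ arc₁ arc₂ x₁≺x₂ Vx₁ (DPath⇒apex-Anc p₂)
        (inj₂ x₂≺x₁) → ordered-arcs-⊥ arc₂ arc₁ x₂≺x₁ Vx₂ (DPath⇒apex-Anc p₁)

lemma12 : ∀ {n m} (T : RootedTree n) (L : Links n m) →
    let open Setup T L in
    (F : Fin m → Set) → WithF.CoversTree F →
    (U : Fin m → Set) → (∀ u → U u → UpLink u) →
    (∀ u u' → U u → U u' → u ≢ u' → ∀ c → ¬ (P u c × P u' c)) →
    (Fu : Fin m → Fin m → Set) → WithF.WithU.ValidChoice F U Fu →
    let open WithF.WithU F U Fu in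
    (ℓ : Fin m) → F ℓ →
    (ρ : Fin m) → Conn ℓ ρ → (∀ u x → ¬ Arc u x ρ) →
    (H : DPath ρ ℓ) →
    CardLe (λ ℓ' → (F ℓ' × Conn ℓ ℓ') × ℓ' ≢ ℓ × ∃[ w ] (IsApex ℓ w × V ℓ' w))
           (λ u → U u × UsesLabel H u)
lemma12 T L F _ U U-up U-disjoint Fu valid ℓ _ _ _ ρ-source H xs ys xs-unique _ xs-spec ys-spec =
  length-≤-by-injection _≟_ xs ys xs-unique (All.tabulate image)
    λ ℓ₁∈xs ℓ₂∈xs from₁ from₂ → ArcFrom-injective from₁ from₂ (apex-on ℓ₁∈xs) (apex-on ℓ₂∈xs)
  where
    open Tree T L
    open DependencyGraph F U U-up U-disjoint Fu valid

    apex-on : ∀ {ℓ′} → ℓ′ ∈ xs → V ℓ′ (apex ℓ)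
    apex-on ℓ′∈xs with proj₁ (xs-spec _) ℓ′∈xs
    ... | _ , _ , w , w-apex , Vw = subst (V _) (IsApex⇒≡apex ℓ w-apex) Vw

    image : ∀ {ℓ′} → ℓ′ ∈ xs → ∃[ u ] (u ∈ ys × ArcFrom H ℓ′ u)
    image ℓ′∈xs with proj₁ (xs-spec _) ℓ′∈xs
    ... | (_ , ℓ~ℓ′) , ℓ′≢ℓ , _
        with DPath-through H (Conn⇒DPath ρ-source H ℓ~ℓ′) ℓ′≢ℓ (apex-on ℓ′∈xs)
    ...   | u , from = u , proj₂ (ys-spec u) (ArcFrom⇒U from , ArcFrom⇒UsesLabel from) , from
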